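{- For all $k\ge 0$ and all graphs $G,G'$ the following are equivalent. (i) For all graphs $F$ of tree depth at most $k$, $\hom(F,G)=\hom(F,G')$. (ii) For all $D\in\mathcal D_k$, $\mathrm{pi\text{ - }hom}(D,G)=\mathrm{pi\text{ - }hom}(D,G')$. (iii) For all $D\in\mathcal D_k$, $\mathrm{pp\text{ - }hom}(D,G)=\mathrm{pp\text{ - }hom}(D,G')$.
   Context: Graphs are finite, undirected, vertex-coloured triples $(V(G),E(G),\gamma^G)$. A homomorphism preserves edges and colours; $\hom$ counts homomorphisms. A forest is a finite poset $(V,\preceq)$ in which each $\{u:u\preceq t\}$ is a chain; a tree is a forest with a unique minimal element; height = maximum number of elements in a chain. An elimination forest (tree) of a graph $F$ is a forest (tree) on $V(F)$ with $u\preceq v$ or $v\preceq u$ for every edge $uv$; the tree depth of $F$ is the minimum height of an elimination forest. $\mathcal D_k$ is the class of pairs $D=(F,T)$ with $F$ a graph (not necessarily connected) and $T$ an elimination tree of $F$ of height at most $k$; homomorphisms from $D$ are homomorphisms from $F$. A homomorphism $h:D\to H$ is past-injective if $h(u)\ne h(v)$ whenever $u\prec^T v$; it is past-preserving if moreover for all $u\preceq^T v$: $uv\in E(F)\iff h(u)h(v)\in E(H)$. $\mathrm{pi\text{ - }hom}$, $\mathrm{pp\text{ - }hom}$ count them. -}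

module Defs where

open import Data.Nat using (ℕ; zero; suc; _≤_)
open import Data.Fin using (Fin; zero; suc)
import Data.Fin.Properties as FinP
open import Data.Bool using (Bool; true; false)
import Data.Bool.Properties as BoolP
import Data.Nat.Properties as NatP
open import Data.List using (List; []; _∷_; [_]; map; concatMap; length; filter; allFin)
open import Data.List.Relation.Unary.AllPairs using (AllPairs)
open import Data.Product using (Σ; _×_; _,_; ∃)
open import Data.Sum using (_⊎_)
open import Relation.Nullary using (¬_; Dec)
open import Relation.Nullary.Decidable using (_×-dec_; _→-dec_; ¬?)
open import Relation.Binary.PropositionalEquality using (_≡_; _≢_)

record Graph : Set where
  field
    n     : ℕ
    adj   : Fin n → Fin n → Bool
    sym   : ∀ u v → adj u v ≡ adj v u
    irr   : ∀ u → adj u u ≡ false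
    col   : Fin n → ℕ

open Graph public

V : Graph → Set
V G = Fin (n G)

Edge : (G : Graph) → V G → V G → Set
Edge G u v = adj G u v ≡ true

IsHom : (F G : Graph) → (V F → V G) → Set
IsHom F G h = (∀ u v → Edge F u v → Edge G (h u) (h v)) × (∀ u → col G (h u) ≡ col F u)

consF : ∀ {a b} → Fin b → (Fin a → Fin b) → Fin (suc a) → Fin b
consF i f zero    = i
consF i f (suc x) = f x

allFuns : (a b : ℕ) → List (Fin a → Fin b)
allFuns zero    b = [ (λ ()) ]
allFuns (suc a) b = concatMap (λ f → map (λ i → consF i f) (allFin b)) (allFuns a b)

countFuns : (a b : ℕ) (P : (Fin a → Fin b) → Set) → (∀ h → Dec (P h)) → ℕ
countFuns a b P P? = length (filter P? (allFuns a b))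

-- Forests / trees on V(F) given by a (Bool-valued, hence decidable)
-- order relation ≼.

_≼[_]_ : ∀ {m} → Fin m → (Fin m → Fin m → Bool) → Fin m → Set
u ≼[ le ] v = le u v ≡ true

_≺[_]_ : ∀ {m} → Fin m → (Fin m → Fin m → Bool) → Fin m → Set
u ≺[ le ] v = (u ≼[ le ] v) × (u ≢ v)

IsPartialOrder : ∀ {m} → (Fin m → Fin m → Bool) → Set
IsPartialOrder le =
  (∀ u → u ≼[ le ] u) ×
  (∀ u v → u ≼[ le ] v → v ≼[ le ] u → u ≡ v) ×
  (∀ u v w → u ≼[ le ] v → v ≼[ le ] w → u ≼[ le ] w)

Comparable : ∀ {m} → (Fin m → Fin m → Bool) → Fin m → Fin m → Set
Comparable le u v = (u ≼[ le ] v) ⊎ (v ≼[ le ] u)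

IsForest : ∀ {m} → (Fin m → Fin m → Bool) → Set
IsForest le = IsPartialOrder le ×
  (∀ t u v → u ≼[ le ] t → v ≼[ le ] t → Comparable le u v)

Minimal : ∀ {m} → (Fin m → Fin m → Bool) → Fin m → Set
Minimal le r = ∀ v → v ≼[ le ] r → v ≡ r

IsTree : ∀ {m} → (Fin m → Fin m → Bool) → Set
IsTree le = IsForest le × (Σ _ λ r → Minimal le r × (∀ s → Minimal le s → s ≡ r))

IsChain : ∀ {m} → (Fin m → Fin m → Bool) → List (Fin m) → Set
IsChain le xs = AllPairs _≢_ xs × AllPairs (Comparable le) xs

HeightAtMost : ∀ {m} → ℕ → (Fin m → Fin m → Bool) → Set
HeightAtMost k le = ∀ xs → IsChain le xs → length xs ≤ k

Eliminates : (F : Graph) → (V F → V F → Bool) → Set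
Eliminates F le = ∀ u v → Edge F u v → Comparable le u v

IsEliminationForest : (F : Graph) → (V F → V F → Bool) → Set
IsEliminationForest F le = IsForest le × Eliminates F le

IsEliminationTree : (F : Graph) → (V F → V F → Bool) → Set
IsEliminationTree F le = IsTree le × Eliminates F le

TreeDepthAtMost : ℕ → Graph → Set
TreeDepthAtMost k F = Σ (V F → V F → Bool) λ le → IsEliminationForest F le × HeightAtMost k le

InDk : ℕ → (F : Graph) → (V F → V F → Bool) → Set
InDk k F le = IsEliminationTree F le × HeightAtMost k le

IsPastInjective : (F : Graph) → (V F → V F → Bool) → (G : Graph) → (V F → V G) → Set
IsPastInjective F le G h = IsHom F G h × (∀ u v → u ≺[ le ] v → h u ≢ h v)

IsPastPreserving : (F : Graph) → (V F → V F → Bool) → (G : Graph) → (V F → V G) → Set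
IsPastPreserving F le G h = IsPastInjective F le G h ×
  (∀ u v → u ≼[ le ] v → adj F u v ≡ adj G (h u) (h v))

isHom? : (F G : Graph) → ∀ h → Dec (IsHom F G h)
isHom? F G h =
  FinP.all? (λ u → FinP.all? (λ v →
    (adj F u v BoolP.≟ true) →-dec (adj G (h u) (h v) BoolP.≟ true)))
  ×-dec FinP.all? (λ u → col G (h u) NatP.≟ col F u)

isPI? : ∀ F le G → ∀ h → Dec (IsPastInjective F le G h)
isPI? F le G h = isHom? F G h ×-dec
  FinP.all? (λ u → FinP.all? (λ v →
    ((le u v BoolP.≟ true) ×-dec ¬? (u FinP.≟ v)) →-dec ¬? (h u FinP.≟ h v)))

isPP? : ∀ F le G → ∀ h → Dec (IsPastPreserving F le G h)
isPP? F le G h = isPI? F le G h ×-dec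
  FinP.all? (λ u → FinP.all? (λ v →
    (le u v BoolP.≟ true) →-dec (adj F u v BoolP.≟ adj G (h u) (h v))))

hom : Graph → Graph → ℕ
hom F G = countFuns (n F) (n G) (IsHom F G) (isHom? F G)

pi-hom : (F : Graph) → (V F → V F → Bool) → Graph → ℕ
pi-hom F le G = countFuns (n F) (n G) (IsPastInjective F le G) (isPI? F le G)

pp-hom : (F : Graph) → (V F → V F → Bool) → Graph → ℕ
pp-hom F le G = countFuns (n F) (n G) (IsPastPreserving F le G) (isPP? F le G)

module Submission where

-- Let T be an elimination tree of F. If u ≺ v is a non-edge of F, a past-injective
-- homomorphism h either sends uv to a non-edge or is a homomorphism from F + uv, which T still
-- eliminates. Inducting over the T-comparable pairs, the counts of past-injective homomorphisms that
-- preserve adjacency on any set of comparable pairs are therefore determined by the pi-hom counts of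
-- graphs eliminated by T, and conversely: this gives (ii) ⇔ (iii).
--
-- Sending each vertex v to the T-least ancestor with the same image (the collapse of h) partitions the
-- homomorphisms F → G. Those with identity collapse are the past-injective ones, and those with collapse
-- ρ correspond to the past-injective homomorphisms from the quotient F/ρ, which lies in 𝒟_k and is
-- smaller than F unless ρ is the identity. So hom(F, G) = pi-hom(F, G) + Σ_ρ pi-hom(F/ρ, G), which gives
-- (ii) ⇒ (i) for trees and, by induction on |V(F)|, (i) ⇒ (ii). Forests reduce to trees because hom
-- counts multiply over unions of components.

open import Defs hiding (sym)
open import Level using (0ℓ)
open import Function using (_∘_)
open import Function.Bundles using (_⇔_; mk⇔; Equivalence)
open import Function.Construct.Identity using (⇔-id)
open import Function.Construct.Symmetry using (⇔-sym)
open import Function.Construct.Composition using (_⇔-∘_)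
open import Data.Empty using (⊥; ⊥-elim)
open import Data.Sum using (_⊎_; inj₁; inj₂)
open import Data.Product using (Σ; _×_; _,_; proj₁; proj₂)
open import Data.Product.Relation.Binary.Pointwise.NonDependent using (_×ₛ_)
open import Data.Bool using (Bool; true; false; _∨_)
import Data.Bool.Properties as Bool
open import Data.Nat using (ℕ; zero; suc; _+_; _*_; _≤_; _<_)
import Data.Nat.Properties as ℕ
open import Data.Nat.Induction using (<-wellFounded)
open import Data.Nat.ListAction using (sum)
open import Data.Fin using (Fin; zero; suc)
import Data.Fin.Properties as Fin
open import Data.List
  using (List; []; _∷_; map; concatMap; length; _++_; filter; allFin; lookup; cartesianProduct; cartesianProductWith)
import Data.List.Properties as List
open import Data.List.Relation.Unary.All as All using (All; []; _∷_)
import Data.List.Relation.Unary.All.Properties as AllP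
open import Data.List.Relation.Unary.AllPairs as AllPairs using ([]; _∷_)
import Data.List.Relation.Unary.AllPairs.Properties as AllPairsP
open import Data.List.Relation.Unary.Any as Any using (here; there)
import Data.List.Relation.Unary.Any.Properties as AnyP
import Data.List.Relation.Unary.Unique.Setoid as SetoidUnique
import Data.List.Relation.Unary.Unique.Setoid.Properties as Unique
open import Data.List.Relation.Unary.Unique.Propositional.Properties using (allFin⁺; cartesianProduct⁺)
import Data.List.Membership.Setoid as SetoidMembership
import Data.List.Membership.Setoid.Properties as Membership
open import Data.List.Membership.Propositional.Properties using (∈-lookup; ∈-allFin; ∈-filter⁺; ∈-cartesianProduct⁺)
open import Induction.WellFounded using (Acc; acc)
open import Relation.Nullary using (¬_; Dec; yes; no; does)
open import Relation.Nullary.Decidable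
  using (_×-dec_; _⊎-dec_; _→-dec_; ¬?; map′; decidable-stable; dec-true; dec-false; does-⇔)
open import Relation.Unary using (Pred; Decidable; U; _∩_; ∁; _≐_; _⟨×⟩_)
open import Relation.Unary.Properties using (_∩?_; ∁?)
open import Relation.Binary using (Setoid; _Respects_)
open import Relation.Binary.PropositionalEquality
  using (_≡_; _≢_; refl; sym; trans; cong; cong₂; subst; subst₂; _≗_; _→-setoid_; module ≡-Reasoning)
import Relation.Binary.PropositionalEquality as ≡

module _ {A : Set} where

  count : {P : A → Set} → Decidable P → List A → ℕ
  count P? xs = length (filter P? xs)

  count-cong : {P Q : A → Set} (P? : Decidable P) (Q? : Decidable Q) → P ≐ Q → ∀ xs → count P? xs ≡ count Q? xs
  count-cong P? Q? P≐Q xs = cong length (List.filter-≐ P? Q? P≐Q xs)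

  count-split : {P Q : A → Set} (P? : Decidable P) (Q? : Decidable Q) →
    ∀ xs → count P? xs ≡ count (P? ∩? Q?) xs + count (P? ∩? ∁? Q?) xs
  count-split P? Q? [] = refl
  count-split P? Q? (x ∷ xs) with P? x | Q? x
  ... | yes _ | yes _ = cong suc (count-split P? Q? xs)
  ... | yes _ | no  _ = trans (cong suc (count-split P? Q? xs)) (sym (ℕ.+-suc _ _))
  ... | no  _ | _     = count-split P? Q? xs

sum-map-cong : {A : Set} {f g : A → ℕ} {xs : List A} → All (λ x → f x ≡ g x) xs → sum (map f xs) ≡ sum (map g xs)
sum-map-cong []       = refl
sum-map-cong (e ∷ es) = cong₂ _+_ e (sum-map-cong es)

module _ {A : Set} (S : Setoid 0ℓ 0ℓ) where

  open Setoid S using (_≈_) renaming (Carrier to J; sym to ≈-sym; trans to ≈-trans)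
  open SetoidMembership S
  open SetoidUnique S

  -- Every P-element has its class c x among the pairwise distinct js, so exactly one summand counts it.
  count-partition : {P : A → Set} (P? : Decidable P) (c : A → J) (_≟_ : ∀ i j → Dec (i ≈ j)) →
    ∀ {js} → Unique js → (∀ {x} → P x → c x ∈ js) →
    ∀ xs → count P? xs ≡ sum (map (λ j → count (P? ∩? λ x → c x ≟ j) xs) js)
  count-partition P? c _≟_ {[]} [] cover xs =
    cong length (List.filter-none P? (All.universal (λ x Px → Membership.∉[] S (cover Px)) xs))
  count-partition {P} P? c _≟_ {j ∷ js} (j∉js ∷ js!) cover xs = begin
    count P? xs
      ≡⟨ count-split P? c≟j xs ⟩
    count (P? ∩? c≟j) xs + count (P? ∩? ∁? c≟j) xs
      ≡⟨ cong (count (P? ∩? c≟j) xs +_) (count-partition (P? ∩? ∁? c≟j) c _≟_ js! cover′ xs) ⟩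
    count (P? ∩? c≟j) xs + sum (map (λ i → count ((P? ∩? ∁? c≟j) ∩? λ x → c x ≟ i) xs) js)
      ≡⟨ cong (count (P? ∩? c≟j) xs +_)
              (sum-map-cong (All.map (λ j≉i → count-cong _ _ (forget , remember j≉i) xs) j∉js)) ⟩
    count (P? ∩? c≟j) xs + sum (map (λ i → count (P? ∩? λ x → c x ≟ i) xs) js)
      ∎
    where
    open ≡-Reasoning
    c≟j : ∀ x → Dec (c x ≈ j)
    c≟j x = c x ≟ j
    cover′ : ∀ {x} → (P ∩ ∁ λ x → c x ≈ j) x → c x ∈ js
    cover′ (Px , cx≉j) with cover Px
    ... | here cx≈j = ⊥-elim (cx≉j cx≈j)
    ... | there cx∈js = cx∈js
    forget : ∀ {i x} → ((P ∩ ∁ λ x → c x ≈ j) ∩ λ x → c x ≈ i) x → (P ∩ λ x → c x ≈ i) x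
    forget ((Px , _) , cx≈i) = Px , cx≈i
    remember : ∀ {i} → ¬ j ≈ i →
      ∀ {x} → (P ∩ λ x → c x ≈ i) x → ((P ∩ ∁ λ x → c x ≈ j) ∩ λ x → c x ≈ i) x
    remember j≉i (Px , cx≈i) = (Px , λ cx≈j → j≉i (≈-trans (≈-sym cx≈j) cx≈i)) , cx≈i

module _ (S : Setoid 0ℓ 0ℓ) where

  open Setoid S using (_≈_)
  open SetoidUnique S

  lookup-injective : ∀ {xs} → Unique xs → ∀ i j → lookup xs i ≈ lookup xs j → i ≡ j
  lookup-injective (_   ∷ _)   zero    zero    _   = refl
  lookup-injective (x∉ ∷ _)    zero    (suc j) x≈y = ⊥-elim (All.lookup x∉ (∈-lookup j) x≈y)
  lookup-injective (x∉ ∷ _)    (suc i) zero    y≈x = ⊥-elim (All.lookup x∉ (∈-lookup i) (Setoid.sym S y≈x))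
  lookup-injective (_  ∷ xs!)  (suc i) (suc j) eq  = cong suc (lookup-injective xs! i j eq)

record Enumerates (S : Setoid 0ℓ 0ℓ) (P : Pred (Setoid.Carrier S) 0ℓ) (xs : List (Setoid.Carrier S)) : Set where
  open SetoidMembership S using (_∈_)
  field
    unique   : SetoidUnique.Unique S xs
    complete : ∀ {x} → P x → x ∈ xs
    sound    : ∀ {x} → x ∈ xs → P x

Embedding : (S T : Setoid 0ℓ 0ℓ) → Pred (Setoid.Carrier S) 0ℓ → Pred (Setoid.Carrier T) 0ℓ → Set
Embedding S T P Q = Σ (Setoid.Carrier S → Setoid.Carrier T) λ f →
  (∀ {x} → P x → Q (f x)) × (∀ {x y} → P x → P y → Setoid._≈_ T (f x) (f y) → Setoid._≈_ S x y)

module _ {S T : Setoid 0ℓ 0ℓ} {P : Pred (Setoid.Carrier S) 0ℓ} {Q : Pred (Setoid.Carrier T) 0ℓ} where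

  open SetoidMembership S using (_∈_)

  embedding⇒length≤ : ∀ {xs ys} → Enumerates S P xs → Enumerates T Q ys →
    Embedding S T P Q → length xs ≤ length ys
  embedding⇒length≤ {xs} {ys} xs-enum ys-enum (f , f-P→Q , f-inj) = Fin.injective⇒≤ index-injective
    where
    open Enumerates xs-enum using () renaming (unique to xs!; sound to xs⊆P)
    open Enumerates ys-enum using () renaming (complete to Q⊆ys)
    ∈xs : ∀ i → lookup xs i ∈ xs
    ∈xs = Membership.∈-lookup S xs
    index : Fin (length xs) → Fin (length ys)
    index i = Any.index (Q⊆ys (f-P→Q (xs⊆P (∈xs i))))
    index-injective : ∀ {i j} → index i ≡ index j → i ≡ j
    index-injective {i} {j} eq = lookup-injective S xs! i j
      (f-inj (xs⊆P (∈xs i)) (xs⊆P (∈xs j)) (Membership.index-injective T _ _ eq))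

cantor-schröder-bernstein : ∀ {S T : Setoid 0ℓ 0ℓ} {P Q xs ys} → Enumerates S P xs → Enumerates T Q ys →
  Embedding S T P Q → Embedding T S Q P → length xs ≡ length ys
cantor-schröder-bernstein xs-enum ys-enum P↪Q Q↪P =
  ℕ.≤-antisym (embedding⇒length≤ xs-enum ys-enum P↪Q) (embedding⇒length≤ ys-enum xs-enum Q↪P)

module _ {S : Setoid 0ℓ 0ℓ} {xs : List (Setoid.Carrier S)} (xs-enum : Enumerates S U xs) where

  filter-enumerates : {P : Pred (Setoid.Carrier S) 0ℓ} (P? : Decidable P) → P Respects (Setoid._≈_ S) →
    Enumerates S P (filter P? xs)
  filter-enumerates P? resp = record
    { unique   = Unique.filter⁺ S P? (Enumerates.unique xs-enum)
    ; complete = λ Px → Membership.∈-filter⁺ S P? resp (Enumerates.complete xs-enum _) Px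
    ; sound    = λ x∈ → proj₂ (Membership.∈-filter⁻ S P? resp {xs = xs} x∈)
    }

module _ {S T : Setoid 0ℓ 0ℓ} {P : Pred (Setoid.Carrier S) 0ℓ} {Q : Pred (Setoid.Carrier T) 0ℓ}
         {xs : List (Setoid.Carrier S)} {ys : List (Setoid.Carrier T)} where

  cartesianProduct-enumerates : Enumerates S P xs → Enumerates T Q ys →
    Enumerates (S ×ₛ T) (P ⟨×⟩ Q) (cartesianProduct xs ys)
  cartesianProduct-enumerates xs-enum ys-enum = record
    { unique   = Unique.cartesianProduct⁺ S T (Enumerates.unique xs-enum) (Enumerates.unique ys-enum)
    ; complete = λ (Px , Qy) → Membership.∈-cartesianProduct⁺ S T
                   (Enumerates.complete xs-enum Px) (Enumerates.complete ys-enum Qy)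
    ; sound    = λ xy∈ → let x∈ , y∈ = Membership.∈-cartesianProduct⁻ S T xs ys xy∈
                         in Enumerates.sound xs-enum x∈ , Enumerates.sound ys-enum y∈
    }

length-cartesianProduct : {A B : Set} (xs : List A) (ys : List B) → length (cartesianProduct xs ys) ≡ length xs * length ys
length-cartesianProduct []       ys = refl
length-cartesianProduct (x ∷ xs) ys = begin
  length (map (x ,_) ys ++ cartesianProduct xs ys)
    ≡⟨ List.length-++ (map (x ,_) ys) ⟩
  length (map (x ,_) ys) + length (cartesianProduct xs ys)
    ≡⟨ cong₂ _+_ (List.length-map (x ,_) ys) (length-cartesianProduct xs ys) ⟩
  length ys + length xs * length ys
    ∎
  where open ≡-Reasoning

Funs : ℕ → ℕ → Setoid 0ℓ 0ℓ
Funs a b = Fin a →-setoid Fin b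

concatMap≡cartesianProductWith : {A B C : Set} (f : A → B → C) (xs : List A) (ys : List B) →
  concatMap (λ x → map (f x) ys) xs ≡ cartesianProductWith f xs ys
concatMap≡cartesianProductWith f []       ys = refl
concatMap≡cartesianProductWith f (x ∷ xs) ys = cong (map (f x) ys ++_) (concatMap≡cartesianProductWith f xs ys)

allFuns-enumerates : ∀ a b → Enumerates (Funs a b) U (allFuns a b)
allFuns-enumerates zero    b = record { unique = [] ∷ [] ; complete = λ _ → here (λ ()) ; sound = _ }
allFuns-enumerates (suc a) b
  rewrite concatMap≡cartesianProductWith (λ f i → consF i f) (allFuns a b) (allFin b) = record
  { unique   = Unique.cartesianProductWith⁺ (Funs a b) (≡.setoid (Fin b)) (Funs (suc a) b) (λ f i → consF i f)
                 (λ e → (λ x → e (suc x)) , e zero) (Enumerates.unique rest) (allFin⁺ b)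
  ; complete = λ {h} _ → Membership.∈-resp-≈ (Funs (suc a) b) consF-head-tail
                 (Membership.∈-cartesianProductWith⁺ (Funs a b) (≡.setoid (Fin b)) (Funs (suc a) b)
                   consF-cong (Enumerates.complete rest _) (∈-allFin (h zero)))
  ; sound    = _
  }
  where
  rest : Enumerates (Funs a b) U (allFuns a b)
  rest = allFuns-enumerates a b
  consF-cong : ∀ {f g i j} → f ≗ g → i ≡ j → consF i f ≗ consF j g
  consF-cong f≗g i≡j zero    = i≡j
  consF-cong f≗g i≡j (suc x) = f≗g x
  consF-head-tail : ∀ {h : Fin (suc a) → Fin b} → consF (h zero) (h ∘ suc) ≗ h
  consF-head-tail zero    = refl
  consF-head-tail (suc x) = refl

countFuns-cong : ∀ {a b} {P Q : Pred (Fin a → Fin b) 0ℓ} (P? : Decidable P) (Q? : Decidable Q) → P ≐ Q →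
  countFuns a b P P? ≡ countFuns a b Q Q?
countFuns-cong {a} {b} P? Q? P≐Q = count-cong P? Q? P≐Q (allFuns a b)

module _ {a b c d : ℕ} {P : Pred (Fin a → Fin b) 0ℓ} {Q : Pred (Fin c → Fin d) 0ℓ}
         (P? : Decidable P) (Q? : Decidable Q) (P-resp : P Respects _≗_) (Q-resp : Q Respects _≗_) where

  countFuns-≡ : Embedding (Funs a b) (Funs c d) P Q → Embedding (Funs c d) (Funs a b) Q P →
    countFuns a b P P? ≡ countFuns c d Q Q?
  countFuns-≡ = cantor-schröder-bernstein
    (filter-enumerates (allFuns-enumerates a b) P? P-resp) (filter-enumerates (allFuns-enumerates c d) Q? Q-resp)

module _ {a b a₁ b₁ a₂ b₂ : ℕ} {P : Pred (Fin a → Fin b) 0ℓ}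
         {P₁ : Pred (Fin a₁ → Fin b₁) 0ℓ} {P₂ : Pred (Fin a₂ → Fin b₂) 0ℓ}
         (P? : Decidable P) (P₁? : Decidable P₁) (P₂? : Decidable P₂)
         (P-resp : P Respects _≗_) (P₁-resp : P₁ Respects _≗_) (P₂-resp : P₂ Respects _≗_) where

  countFuns-* : Embedding (Funs a b) (Funs a₁ b₁ ×ₛ Funs a₂ b₂) P (P₁ ⟨×⟩ P₂) →
    Embedding (Funs a₁ b₁ ×ₛ Funs a₂ b₂) (Funs a b) (P₁ ⟨×⟩ P₂) P →
    countFuns a b P P? ≡ countFuns a₁ b₁ P₁ P₁? * countFuns a₂ b₂ P₂ P₂?
  countFuns-* P↪P₁×P₂ P₁×P₂↪P = trans
    (cantor-schröder-bernstein (filter-enumerates (allFuns-enumerates a b) P? P-resp)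
      (cartesianProduct-enumerates (filter-enumerates (allFuns-enumerates a₁ b₁) P₁? P₁-resp)
                                   (filter-enumerates (allFuns-enumerates a₂ b₂) P₂? P₂-resp))
      P↪P₁×P₂ P₁×P₂↪P)
    (length-cartesianProduct (filter P₁? (allFuns a₁ b₁)) (filter P₂? (allFuns a₂ b₂)))

true≢false : true ≢ false
true≢false ()

∨-true⁻ : ∀ a b → a ∨ b ≡ true → a ≡ true ⊎ b ≡ true
∨-true⁻ true  _ _  = inj₁ refl
∨-true⁻ false _ ab = inj₂ ab

dec-true⁻ : ∀ {X : Set} (x? : Dec X) → does x? ≡ true → X
dec-true⁻ (yes x) _ = x

isHom-resp-≗ : ∀ F G → IsHom F G Respects _≗_
isHom-resp-≗ F G h≗h′ (edges , colours) =
  (λ u v uv → subst₂ (Edge G) (h≗h′ u) (h≗h′ v) (edges u v uv)) ,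
  (λ u → trans (cong (col G) (sym (h≗h′ u))) (colours u))

isPastInjective-resp-≗ : ∀ F T G → IsPastInjective F T G Respects _≗_
isPastInjective-resp-≗ F T G h≗h′ (hom , past-inj) =
  isHom-resp-≗ F G h≗h′ hom , λ u v u≺v eq → past-inj u v u≺v (trans (h≗h′ u) (trans eq (sym (h≗h′ v))))

inhabited? : ∀ m → (Fin m → ⊥) ⊎ Fin m
inhabited? zero    = inj₁ λ ()
inhabited? (suc m) = inj₂ zero

hom-≡-empty : ∀ F {G G′} → (V F → ⊥) → hom F G ≡ hom F G′
hom-≡-empty F {G} {G′} empty = countFuns-≡ (isHom? F G) (isHom? F G′) (isHom-resp-≗ F G) (isHom-resp-≗ F G′)
  ((λ _ v → ⊥-elim (empty v)) , (λ _ → vacuous {G′}) , λ _ _ _ v → ⊥-elim (empty v))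
  ((λ _ v → ⊥-elim (empty v)) , (λ _ → vacuous {G}) , λ _ _ _ v → ⊥-elim (empty v))
  where
  vacuous : ∀ {H} {h : V F → V H} → IsHom F H h
  vacuous = (λ u → ⊥-elim (empty u)) , (λ u → ⊥-elim (empty u))

module _ {m} {T : Fin m → Fin m → Bool} (T-forest : IsForest T) where

  ≼-refl : ∀ u → u ≼[ T ] u
  ≼-refl = proj₁ (proj₁ T-forest)

  ≼-antisym : ∀ u v → u ≼[ T ] v → v ≼[ T ] u → u ≡ v
  ≼-antisym = proj₁ (proj₂ (proj₁ T-forest))

  ≼-trans : ∀ u v w → u ≼[ T ] v → v ≼[ T ] w → u ≼[ T ] w
  ≼-trans = proj₂ (proj₂ (proj₁ T-forest))

  ≼-chain : ∀ t u v → u ≼[ T ] t → v ≼[ T ] t → Comparable T u v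
  ≼-chain = proj₂ T-forest

  least : {Q : Pred (Fin m) 0ℓ} → (∀ {x y} → Q x → Q y → Comparable T x y) →
    ∀ x xs → All Q (x ∷ xs) → Σ (Fin m) λ u → Q u × All (u ≼[ T ]_) (x ∷ xs)
  least cmp x []       (Qx ∷ []) = x , Qx , ≼-refl x ∷ []
  least cmp x (y ∷ ys) (Qx ∷ Qys) with least cmp y ys Qys
  ... | u , Qu , u≼ with cmp Qx Qu
  ...   | inj₁ x≼u = x , Qx , ≼-refl x ∷ All.map (≼-trans x u _ x≼u) u≼
  ...   | inj₂ u≼x = u , Qu , u≼x ∷ u≼

  -- The elements below v form a chain, so any decidable nonempty part of it has a least element.
  least-below : {S : Pred (Fin m) 0ℓ} → Decidable S → ∀ v → S v →
    Σ (Fin m) λ u → S u × u ≼[ T ] v × (∀ w → S w → w ≼[ T ] v → u ≼[ T ] w)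
  least-below {S} S? v Sv with least (λ (_ , x≼v) (_ , y≼v) → ≼-chain v _ _ x≼v y≼v) v below all-below
    where
    Q? : Decidable (S ∩ (_≼[ T ] v))
    Q? = S? ∩? λ w → T w v Bool.≟ true
    below : List (Fin m)
    below = filter Q? (allFin m)
    all-below : All (S ∩ (_≼[ T ] v)) (v ∷ below)
    all-below = (Sv , ≼-refl v) ∷ AllP.all-filter Q? (allFin m)
  ... | u , (Su , u≼v) , _ ∷ u≼below = u , Su , u≼v , λ w Sw w≼v →
    All.lookup u≼below (∈-filter⁺ (S? ∩? λ w → T w v Bool.≟ true) (∈-allFin w) (Sw , w≼v))

  minimal-below : ∀ v → Σ (Fin m) λ r → Minimal T r × r ≼[ T ] v
  minimal-below v with least-below {S = U} (λ _ → yes _) v _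
  ... | r , _ , r≼v , r-least = r , (λ w w≼r → ≼-antisym w r w≼r (r-least w _ (≼-trans w r v w≼r r≼v))) , r≼v

root : ∀ {m} {T : Fin m → Fin m → Bool} → IsTree T → Fin m
root (_ , r , _) = r

root-≼ : ∀ {m} {T : Fin m → Fin m → Bool} (T-tree : IsTree T) → ∀ v → root T-tree ≼[ T ] v
root-≼ {T = T} (T-forest , r , _ , unique) v with minimal-below T-forest v
... | s , s-minimal , s≼v = subst (_≼[ T ] v) (unique s s-minimal) s≼v

above-minimal-closed : ∀ {F T} → IsForest T → Eliminates F T → ∀ {r} → Minimal T r →
  ∀ u v → Edge F u v → r ≼[ T ] u → r ≼[ T ] v
above-minimal-closed {T = T} T-forest elim {r} r-minimal u v uv r≼u with elim u v uv
... | inj₁ u≼v = ≼-trans T-forest _ _ _ r≼u u≼v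
... | inj₂ v≼u with ≼-chain T-forest u r v r≼u v≼u
...   | inj₁ r≼v = r≼v
...   | inj₂ v≼r = subst (r ≼[ T ]_) (sym (r-minimal v v≼r)) (≼-refl T-forest r)

module Subset {m} {P : Pred (Fin m) 0ℓ} (P? : Decidable P) where

  members : List (Fin m)
  members = filter P? (allFin m)

  size : ℕ
  size = length members

  embed : Fin size → Fin m
  embed = lookup members

  embed-injective : ∀ i j → embed i ≡ embed j → i ≡ j
  embed-injective = lookup-injective (≡.setoid (Fin m)) (Unique.filter⁺ (≡.setoid (Fin m)) P? (allFin⁺ m))

  P-embed : ∀ i → P (embed i)
  P-embed i = All.lookup (AllP.all-filter P? (allFin m)) (∈-lookup i)

  index : ∀ v → P v → Fin size
  index v Pv = Any.index (∈-filter⁺ P? (∈-allFin v) Pv)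

  embed-index : ∀ v Pv → embed (index v Pv) ≡ v
  embed-index v Pv = sym (AnyP.lookup-index (∈-filter⁺ P? (∈-allFin v) Pv))

  index-embed : ∀ i Pv → index (embed i) Pv ≡ i
  index-embed i Pv = embed-injective _ _ (embed-index (embed i) Pv)

  size< : ∀ v → ¬ P v → size < m
  size< v ¬Pv = subst (size <_) (List.length-tabulate {n = m} (λ x → x))
    (List.filter-notAll P? (allFin m) (Any.map (λ { refl → ¬Pv }) (∈-allFin v)))

restrict : ∀ {m L} → (Fin m → Fin m → Bool) → (Fin L → Fin m) → Fin L → Fin L → Bool
restrict T ι x y = T (ι x) (ι y)

module _ {m L} {T : Fin m → Fin m → Bool} {ι : Fin L → Fin m} (ι-injective : ∀ i j → ι i ≡ ι j → i ≡ j) where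

  isForest-restrict : IsForest T → IsForest (restrict T ι)
  isForest-restrict T-forest =
    ( (λ u → ≼-refl T-forest (ι u))
    , (λ u v p q → ι-injective u v (≼-antisym T-forest _ _ p q))
    , (λ u v w → ≼-trans T-forest _ _ _) )
    , (λ t u v → ≼-chain T-forest (ι t) (ι u) (ι v))

  isTree-restrict : IsForest T → ∀ i → (∀ j → ι i ≼[ T ] ι j) → IsTree (restrict T ι)
  isTree-restrict T-forest i i≼ = T′-forest , i , minimal , λ s s-minimal → sym (s-minimal i (i≼ s))
    where
    T′-forest : IsForest (restrict T ι)
    T′-forest = isForest-restrict T-forest
    minimal : Minimal (restrict T ι) i
    minimal w w≼i = ≼-antisym T′-forest w i w≼i (i≼ w)

  heightAtMost-restrict : ∀ {k} → HeightAtMost k T → HeightAtMost k (restrict T ι)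
  heightAtMost-restrict {k} height xs (distinct , comparable) = subst (_≤ k) (List.length-map ι xs)
    (height (map ι xs) (AllPairsP.map⁺ (AllPairs.map (λ x≢y ιx≡ιy → x≢y (ι-injective _ _ ιx≡ιy)) distinct) ,
                        AllPairsP.map⁺ comparable))

induced : (F : Graph) {L : ℕ} → (Fin L → V F) → Graph
induced F {L} ι = record
  { n   = L
  ; adj = restrict (adj F) ι
  ; sym = λ x y → Graph.sym F (ι x) (ι y)
  ; irr = λ x → irr F (ι x)
  ; col = col F ∘ ι
  }

record EdgeSet (m : ℕ) : Set where
  field
    edge     : Fin m → Fin m → Bool
    edge-sym : ∀ u v → edge u v ≡ edge v u
    edge-irr : ∀ u → edge u u ≡ false

open EdgeSet

withEdges : (F : Graph) → EdgeSet (n F) → Graph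
withEdges F E = record { n = n F ; adj = edge E ; sym = edge-sym E ; irr = edge-irr E ; col = col F }

edgeSet : (F : Graph) → EdgeSet (n F)
edgeSet F = record { edge = adj F ; edge-sym = Graph.sym F ; edge-irr = irr F }

IsPair : ∀ {m} → Fin m → Fin m → Fin m → Fin m → Set
IsPair u v x y = (x ≡ u × y ≡ v) ⊎ (x ≡ v × y ≡ u)

isPair? : ∀ {m} (u v x y : Fin m) → Dec (IsPair u v x y)
isPair? u v x y = (x Fin.≟ u ×-dec y Fin.≟ v) ⊎-dec (x Fin.≟ v ×-dec y Fin.≟ u)

addEdge : ∀ {m} → EdgeSet m → (u v : Fin m) → u ≢ v → EdgeSet m
addEdge E u v u≢v = record
  { edge     = λ x y → edge E x y ∨ does (isPair? u v x y)
  ; edge-sym = λ x y → cong₂ _∨_ (edge-sym E x y) (does-⇔ (mk⇔ swap swap) (isPair? u v x y) (isPair? u v y x))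
  ; edge-irr = λ x → cong₂ _∨_ (edge-irr E x) (dec-false (isPair? u v x x) (u≢v ∘ diagonal))
  }
  where
  swap : ∀ {x y} → IsPair u v x y → IsPair u v y x
  swap (inj₁ (x≡u , y≡v)) = inj₂ (y≡v , x≡u)
  swap (inj₂ (x≡v , y≡u)) = inj₁ (y≡u , x≡v)
  diagonal : ∀ {x} → IsPair u v x x → u ≡ v
  diagonal (inj₁ (x≡u , x≡v)) = trans (sym x≡u) x≡v
  diagonal (inj₂ (x≡v , x≡u)) = trans (sym x≡u) x≡v

PreservesOn : (F G : Graph) → (V F → V G) → List (V F × V F) → Set
PreservesOn F G h = All λ (u , v) → adj F u v ≡ adj G (h u) (h v)

IsPastInjectiveOn : (F : Graph) → (V F → V F → Bool) → (G : Graph) → List (V F × V F) → (V F → V G) → Set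
IsPastInjectiveOn F T G M h = IsPastInjective F T G h × PreservesOn F G h M

isPIOn? : ∀ F T G M h → Dec (IsPastInjectiveOn F T G M h)
isPIOn? F T G M h = isPI? F T G h ×-dec All.all? (λ (u , v) → adj F u v Bool.≟ adj G (h u) (h v)) M

pi-homOn : (F : Graph) → (V F → V F → Bool) → Graph → List (V F × V F) → ℕ
pi-homOn F T G M = countFuns (n F) (n G) (IsPastInjectiveOn F T G M) (isPIOn? F T G M)

pi-hom≡pi-homOn[] : ∀ F T G → pi-hom F T G ≡ pi-homOn F T G []
pi-hom≡pi-homOn[] F T G = countFuns-cong (isPI? F T G) (isPIOn? F T G []) ((_, []) , proj₁)

≼-pair? : ∀ {m} (T : Fin m → Fin m → Bool) → Decidable (λ ((u , v) : Fin m × Fin m) → u ≼[ T ] v)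
≼-pair? T (u , v) = T u v Bool.≟ true

≼-pairs : ∀ {m} → (Fin m → Fin m → Bool) → List (Fin m × Fin m)
≼-pairs {m} T = filter (≼-pair? T) (cartesianProduct (allFin m) (allFin m))

pp-hom≡pi-homOn-≼-pairs : ∀ F T G → pp-hom F T G ≡ pi-homOn F T G (≼-pairs T)
pp-hom≡pi-homOn-≼-pairs F T G = countFuns-cong (isPP? F T G) (isPIOn? F T G (≼-pairs T)) (to , from)
  where
  to : ∀ {h} → IsPastPreserving F T G h → IsPastInjectiveOn F T G (≼-pairs T) h
  to (pi , preserves) = pi , All.map (λ {(u , v)} → preserves u v)
    (AllP.all-filter (≼-pair? T) (cartesianProduct (allFin (n F)) (allFin (n F))))
  from : ∀ {h} → IsPastInjectiveOn F T G (≼-pairs T) h → IsPastPreserving F T G h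
  from (pi , preserves) = pi , λ u v u≼v → All.lookup preserves
    (∈-filter⁺ (≼-pair? T) (∈-cartesianProduct⁺ (∈-allFin u) (∈-allFin v)) u≼v)

module _ (F : Graph) (T : V F → V F → Bool) (G : Graph) where

  pi-homOn-∷-redundant : ∀ M u v → (∀ {h} → IsPastInjectiveOn F T G M h → adj F u v ≡ adj G (h u) (h v)) →
    pi-homOn F T G ((u , v) ∷ M) ≡ pi-homOn F T G M
  pi-homOn-∷-redundant M u v forced =
    countFuns-cong (isPIOn? F T G ((u , v) ∷ M)) (isPIOn? F T G M)
      ((λ { (pi , _ ∷ pres) → pi , pres }) , λ (pi , pres) → pi , forced (pi , pres) ∷ pres)

  pi-homOn-∷-edge : ∀ M u v → Edge F u v → pi-homOn F T G ((u , v) ∷ M) ≡ pi-homOn F T G M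
  pi-homOn-∷-edge M u v uv = pi-homOn-∷-redundant M u v λ (((edges , _) , _) , _) → trans uv (sym (edges u v uv))

  pi-homOn-∷-diagonal : ∀ M u → pi-homOn F T G ((u , u) ∷ M) ≡ pi-homOn F T G M
  pi-homOn-∷-diagonal M u = pi-homOn-∷-redundant M u u λ {h} _ → trans (irr F u) (sym (irr G (h u)))

  module _ {u v : V F} (u≢v : u ≢ v) where

    private
      F+uv : Graph
      F+uv = withEdges F (addEdge (edgeSet F) u v u≢v)

      isPair-uv : does (isPair? u v u v) ≡ true
      isPair-uv = dec-true (isPair? u v u v) (inj₁ (refl , refl))

      isHom-F+uv : ∀ {h} → IsHom F+uv G h ⇔ (IsHom F G h × Edge G (h u) (h v))
      isHom-F+uv {h} = mk⇔
        (λ (edges , colours) → ((λ x y xy → edges x y (cong (_∨ _) xy)) , colours) ,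
                               edges u v (trans (cong (adj F u v ∨_) isPair-uv) (Bool.∨-zeroʳ _)))
        (λ ((edges , colours) , huv) → (λ x y xy → new-edge x y huv edges (∨-true⁻ _ _ xy)) , colours)
        where
        new-edge : ∀ x y → Edge G (h u) (h v) → (∀ x y → Edge F x y → Edge G (h x) (h y)) →
          Edge F x y ⊎ does (isPair? u v x y) ≡ true → Edge G (h x) (h y)
        new-edge x y _   edges (inj₁ xy) = edges x y xy
        new-edge x y huv _     (inj₂ p) with dec-true⁻ (isPair? u v x y) p
        ... | inj₁ (refl , refl) = huv
        ... | inj₂ (refl , refl) = trans (Graph.sym G (h v) (h u)) huv

      preservesOn-F+uv : ∀ {h} M → All (λ (x , y) → ¬ IsPair u v x y) M → PreservesOn F+uv G h M ⇔ PreservesOn F G h M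
      preservesOn-F+uv M avoids = mk⇔
        (λ pres → All.zipWith (λ (¬p , e) → trans (sym (unchanged ¬p)) e) (avoids , pres))
        (λ pres → All.zipWith (λ (¬p , e) → trans (unchanged ¬p) e) (avoids , pres))
        where
        unchanged : ∀ {x y} → ¬ IsPair u v x y → adj F x y ∨ does (isPair? u v x y) ≡ adj F x y
        unchanged {x} {y} ¬p = trans (cong (adj F x y ∨_) (dec-false (isPair? u v x y) ¬p)) (Bool.∨-identityʳ _)

    -- h either sends the non-edge uv to a non-edge or is a homomorphism from F + uv.
    pi-homOn-split : ∀ M → adj F u v ≡ false → All (λ (x , y) → ¬ IsPair u v x y) M →
      pi-homOn F T G M ≡ pi-homOn F T G ((u , v) ∷ M) + pi-homOn F+uv T G M
    pi-homOn-split M ¬uv avoids = trans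
      (count-split (isPIOn? F T G M) (λ h → adj G (h u) (h v) Bool.≟ false) (allFuns (n F) (n G)))
      (cong₂ _+_ (countFuns-cong _ (isPIOn? F T G ((u , v) ∷ M)) (non-edge-to , non-edge-from))
                 (countFuns-cong _ (isPIOn? F+uv T G M) (edge-to , edge-from)))
      where
      non-edge-to : ∀ {h} → IsPastInjectiveOn F T G M h × adj G (h u) (h v) ≡ false →
        IsPastInjectiveOn F T G ((u , v) ∷ M) h
      non-edge-to ((pi , pres) , ¬huv) = pi , trans ¬uv (sym ¬huv) ∷ pres
      non-edge-from : ∀ {h} → IsPastInjectiveOn F T G ((u , v) ∷ M) h →
        IsPastInjectiveOn F T G M h × adj G (h u) (h v) ≡ false
      non-edge-from (pi , uv-pres ∷ pres) = (pi , pres) , trans (sym uv-pres) ¬uv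
      edge-to : ∀ {h} → IsPastInjectiveOn F T G M h × ¬ adj G (h u) (h v) ≡ false → IsPastInjectiveOn F+uv T G M h
      edge-to (((hom , past-inj) , pres) , huv) =
        (Equivalence.from isHom-F+uv (hom , Bool.¬-not huv) , past-inj) , Equivalence.from (preservesOn-F+uv M avoids) pres
      edge-from : ∀ {h} → IsPastInjectiveOn F+uv T G M h → IsPastInjectiveOn F T G M h × ¬ adj G (h u) (h v) ≡ false
      edge-from ((hom , past-inj) , pres) with Equivalence.to isHom-F+uv hom
      ... | hom′ , huv = ((hom′ , past-inj) , Equivalence.to (preservesOn-F+uv M avoids) pres) ,
                         λ ¬huv → true≢false (trans (sym huv) ¬huv)

module _ (F : Graph) (T : V F → V F → Bool) (G G′ : Graph) where

  private
    #pi : Graph → EdgeSet (n F) → List (V F × V F) → ℕ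
    #pi H E = pi-homOn (withEdges F E) T H

  Agree : List (V F × V F) → Set
  Agree M = ∀ E → Eliminates (withEdges F E) T → #pi G E M ≡ #pi G′ E M

  private
    data Case (u v : V F) (M : List (V F × V F)) (E : EdgeSet (n F)) : Set where
      redundant : (∀ H → #pi H E ((u , v) ∷ M) ≡ #pi H E M) → Case u v M E
      non-edge  : (u≢v : u ≢ v) → edge E u v ≡ false → Case u v M E

    case : ∀ u v M E → Case u v M E
    case u v M E with u Fin.≟ v | edge E u v in uv
    ... | yes refl | _     = redundant λ H → pi-homOn-∷-diagonal (withEdges F E) T H M u
    ... | no  _    | true  = redundant λ H → pi-homOn-∷-edge (withEdges F E) T H M u v uv
    ... | no  u≢v  | false = non-edge u≢v uv

  agree-∷ : ∀ {u v M} → u ≼[ T ] v → All (λ (x , y) → ¬ IsPair u v x y) M → Agree ((u , v) ∷ M) ⇔ Agree M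
  agree-∷ {u} {v} {M} u≼v avoids = mk⇔ to from
    where
    open ≡-Reasoning
    eliminates-+uv : ∀ {E} u≢v → Eliminates (withEdges F E) T → Eliminates (withEdges F (addEdge E u v u≢v)) T
    eliminates-+uv {E} _ elim x y xy with ∨-true⁻ (edge E x y) _ xy
    ... | inj₁ exy = elim x y exy
    ... | inj₂ p with dec-true⁻ (isPair? u v x y) p
    ...   | inj₁ (refl , refl) = inj₁ u≼v
    ...   | inj₂ (refl , refl) = inj₂ u≼v

    to : Agree ((u , v) ∷ M) → Agree M
    to agree E elim with case u v M E
    ... | redundant same = trans (sym (same G)) (trans (agree E elim) (same G′))
    ... | non-edge u≢v ¬uv = begin
      #pi G E M                                ≡⟨ pi-homOn-split (withEdges F E) T G u≢v M ¬uv avoids ⟩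
      #pi G E ((u , v) ∷ M) + #pi G E+uv M     ≡⟨ cong₂ _+_ (agree E elim) (agree-+uv) ⟩
      #pi G′ E ((u , v) ∷ M) + #pi G′ E+uv M   ≡⟨ pi-homOn-split (withEdges F E) T G′ u≢v M ¬uv avoids ⟨
      #pi G′ E M                               ∎
      where
      E+uv : EdgeSet (n F)
      E+uv = addEdge E u v u≢v
      uv∈E+uv : Edge (withEdges F E+uv) u v
      uv∈E+uv = trans (cong (edge E u v ∨_) (dec-true (isPair? u v u v) (inj₁ (refl , refl)))) (Bool.∨-zeroʳ _)
      agree-+uv : #pi G E+uv M ≡ #pi G′ E+uv M
      agree-+uv = begin
        #pi G E+uv M              ≡⟨ pi-homOn-∷-edge (withEdges F E+uv) T G M u v uv∈E+uv ⟨
        #pi G E+uv ((u , v) ∷ M)  ≡⟨ agree E+uv (eliminates-+uv {E} u≢v elim) ⟩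
        #pi G′ E+uv ((u , v) ∷ M) ≡⟨ pi-homOn-∷-edge (withEdges F E+uv) T G′ M u v uv∈E+uv ⟩
        #pi G′ E+uv M             ∎

    from : Agree M → Agree ((u , v) ∷ M)
    from agree E elim with case u v M E
    ... | redundant same = trans (same G) (trans (agree E elim) (sym (same G′)))
    ... | non-edge u≢v ¬uv = ℕ.+-cancelʳ-≡ (#pi G E+uv M) _ _ (begin
      #pi G E ((u , v) ∷ M) + #pi G E+uv M     ≡⟨ pi-homOn-split (withEdges F E) T G u≢v M ¬uv avoids ⟨
      #pi G E M                                ≡⟨ agree E elim ⟩
      #pi G′ E M                               ≡⟨ pi-homOn-split (withEdges F E) T G′ u≢v M ¬uv avoids ⟩
      #pi G′ E ((u , v) ∷ M) + #pi G′ E+uv M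
        ≡⟨ cong (#pi G′ E ((u , v) ∷ M) +_) (agree E+uv (eliminates-+uv {E} u≢v elim)) ⟨
      #pi G′ E ((u , v) ∷ M) + #pi G E+uv M    ∎)
      where
      E+uv : EdgeSet (n F)
      E+uv = addEdge E u v u≢v

  agree-[]⇔agree : (∀ u v → u ≼[ T ] v → v ≼[ T ] u → u ≡ v) →
    ∀ M → All (λ (u , v) → u ≼[ T ] v) M → SetoidUnique.Unique (≡.setoid _) M → Agree [] ⇔ Agree M
  agree-[]⇔agree antisym []              []           []           = ⇔-id _
  agree-[]⇔agree antisym ((u , v) ∷ M) (u≼v ∷ M-≼) (uv∉M ∷ M!) =
    ⇔-sym (agree-∷ u≼v (All.zipWith avoids (M-≼ , uv∉M))) ⇔-∘ agree-[]⇔agree antisym M M-≼ M!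
    where
    avoids : ∀ {(x , y) : V F × V F} → x ≼[ T ] y × (u , v) ≢ (x , y) → ¬ IsPair u v x y
    avoids (_   , uv≢xy) (inj₁ (refl , refl)) = uv≢xy refl
    avoids (v≼u , uv≢xy) (inj₂ (refl , refl)) with antisym u v u≼v v≼u
    ... | refl = uv≢xy refl

-- Equivalence of (ii) and (iii)

HomIndistinguishable : ℕ → Graph → Graph → Set
HomIndistinguishable k G G′ = ∀ (F : Graph) → TreeDepthAtMost k F → hom F G ≡ hom F G′

PiHomIndistinguishable : ℕ → Graph → Graph → Set
PiHomIndistinguishable k G G′ = ∀ (F : Graph) (T : V F → V F → Bool) → InDk k F T → pi-hom F T G ≡ pi-hom F T G′

PpHomIndistinguishable : ℕ → Graph → Graph → Set
PpHomIndistinguishable k G G′ = ∀ (F : Graph) (T : V F → V F → Bool) → InDk k F T → pp-hom F T G ≡ pp-hom F T G′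

module _ {k : ℕ} {G G′ F : Graph} {T : V F → V F → Bool} (T-tree : IsTree T) (height : HeightAtMost k T) where

  agree-[]⇔agree-≼-pairs : Agree F T G G′ [] ⇔ Agree F T G G′ (≼-pairs T)
  agree-[]⇔agree-≼-pairs = agree-[]⇔agree F T G G′ (≼-antisym (proj₁ T-tree)) (≼-pairs T)
    (AllP.all-filter (≼-pair? T) (cartesianProduct (allFin (n F)) (allFin (n F))))
    (Unique.filter⁺ (≡.setoid _) (≼-pair? T) (cartesianProduct⁺ (allFin⁺ (n F)) (allFin⁺ (n F))))

  pi-indistinguishable⇒agree : PiHomIndistinguishable k G G′ → Agree F T G G′ []
  pi-indistinguishable⇒agree pi-eq E elim =
    trans (sym (pi-hom≡pi-homOn[] (withEdges F E) T G))
      (trans (pi-eq (withEdges F E) T ((T-tree , elim) , height)) (pi-hom≡pi-homOn[] (withEdges F E) T G′))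

  pp-indistinguishable⇒agree : PpHomIndistinguishable k G G′ → Agree F T G G′ (≼-pairs T)
  pp-indistinguishable⇒agree pp-eq E elim =
    trans (sym (pp-hom≡pi-homOn-≼-pairs (withEdges F E) T G))
      (trans (pp-eq (withEdges F E) T ((T-tree , elim) , height)) (pp-hom≡pi-homOn-≼-pairs (withEdges F E) T G′))

  pi-indistinguishable⇒pp-hom-≡ : PiHomIndistinguishable k G G′ → Eliminates F T → pp-hom F T G ≡ pp-hom F T G′
  pi-indistinguishable⇒pp-hom-≡ pi-eq elim = begin
    pp-hom F T G                        ≡⟨ pp-hom≡pi-homOn-≼-pairs F T G ⟩
    pi-homOn F T G (≼-pairs T)
      ≡⟨ Equivalence.to agree-[]⇔agree-≼-pairs (pi-indistinguishable⇒agree pi-eq) (edgeSet F) elim ⟩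
    pi-homOn F T G′ (≼-pairs T) ≡⟨ pp-hom≡pi-homOn-≼-pairs F T G′ ⟨
    pp-hom F T G′                       ∎
    where open ≡-Reasoning

  pp-indistinguishable⇒pi-hom-≡ : PpHomIndistinguishable k G G′ → Eliminates F T → pi-hom F T G ≡ pi-hom F T G′
  pp-indistinguishable⇒pi-hom-≡ pp-eq elim = begin
    pi-hom F T G       ≡⟨ pi-hom≡pi-homOn[] F T G ⟩
    pi-homOn F T G []
      ≡⟨ Equivalence.from agree-[]⇔agree-≼-pairs (pp-indistinguishable⇒agree pp-eq) (edgeSet F) elim ⟩
    pi-homOn F T G′ [] ≡⟨ pi-hom≡pi-homOn[] F T G′ ⟨
    pi-hom F T G′      ∎
    where open ≡-Reasoning

pi⇔pp-indistinguishable : ∀ k G G′ → PiHomIndistinguishable k G G′ ⇔ PpHomIndistinguishable k G G′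
pi⇔pp-indistinguishable k G G′ = mk⇔
  (λ pi-eq F T ((T-tree , elim) , height) → pi-indistinguishable⇒pp-hom-≡ {G = G} {G′} {F} T-tree height pi-eq elim)
  (λ pp-eq F T ((T-tree , elim) , height) → pp-indistinguishable⇒pi-hom-≡ {G = G} {G′} {F} T-tree height pp-eq elim)

-- Collapsing a map along an elimination forest

module Collapse {m} {T : Fin m → Fin m → Bool} (T-forest : IsForest T) {b} (h : Fin m → Fin b) where

  private
    lowest : ∀ v →
      Σ (Fin m) λ u → h u ≡ h v × u ≼[ T ] v × (∀ w → h w ≡ h v → w ≼[ T ] v → u ≼[ T ] w)
    lowest v = least-below T-forest (λ w → h w Fin.≟ h v) v refl

  collapse : Fin m → Fin m
  collapse v = proj₁ (lowest v)

  collapse-same : ∀ v → h (collapse v) ≡ h v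
  collapse-same v = proj₁ (proj₂ (lowest v))

  collapse-≼ : ∀ v → collapse v ≼[ T ] v
  collapse-≼ v = proj₁ (proj₂ (proj₂ (lowest v)))

  collapse-least : ∀ v w → h w ≡ h v → w ≼[ T ] v → collapse v ≼[ T ] w
  collapse-least v = proj₂ (proj₂ (proj₂ (lowest v)))

  collapse-unique : ∀ v u → u ≼[ T ] v → h u ≡ h v →
    (∀ w → h w ≡ h v → w ≼[ T ] v → u ≼[ T ] w) → collapse v ≡ u
  collapse-unique v u u≼v hu≡hv u-least =
    ≼-antisym T-forest _ _ (collapse-least v u hu≡hv u≼v) (u-least (collapse v) (collapse-same v) (collapse-≼ v))

  collapse-idempotent : ∀ v → collapse (collapse v) ≡ collapse v
  collapse-idempotent v = collapse-unique (collapse v) (collapse v) (≼-refl T-forest _) refl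
    λ w hw≡ w≼ → collapse-least v w (trans hw≡ (collapse-same v)) (≼-trans T-forest _ _ _ w≼ (collapse-≼ v))

collapse-resp-≗ : ∀ {m} {T : Fin m → Fin m → Bool} (T-forest : IsForest T) {b} {h h′ : Fin m → Fin b} →
  h ≗ h′ → Collapse.collapse T-forest h ≗ Collapse.collapse T-forest h′
collapse-resp-≗ T-forest {h = h} {h′} h≗h′ v = sym (C′.collapse-unique v (C.collapse v) (C.collapse-≼ v)
  (trans (sym (h≗h′ _)) (trans (C.collapse-same v) (h≗h′ v)))
  (λ w h′w≡ w≼v → C.collapse-least v w (trans (h≗h′ w) (trans h′w≡ (sym (h≗h′ v)))) w≼v))
  where
  module C  = Collapse T-forest h
  module C′ = Collapse T-forest h′

_≗?_ : ∀ {a b} (f g : Fin a → Fin b) → Dec (f ≗ g)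
f ≗? g = Fin.all? λ x → f x Fin.≟ g x

record IsCollapse (F : Graph) (T : V F → V F → Bool) (ρ : V F → V F) : Set where
  field
    below      : ∀ v → ρ v ≼[ T ] v
    idempotent : ∀ v → ρ (ρ v) ≡ ρ v
    colour     : ∀ v → col F (ρ v) ≡ col F v
    separates  : ∀ u v → Edge F u v → ρ u ≢ ρ v

isCollapse? : ∀ F T ρ → Dec (IsCollapse F T ρ)
isCollapse? F T ρ = map′ (λ (b , i , c , s) → record { below = b ; idempotent = i ; colour = c ; separates = s })
  (λ r → let open IsCollapse r in below , idempotent , colour , separates)
  (Fin.all? (λ v → T (ρ v) v Bool.≟ true) ×-dec Fin.all? (λ v → ρ (ρ v) Fin.≟ ρ v) ×-dec
   Fin.all? (λ v → col F (ρ v) ℕ.≟ col F v) ×-dec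
   Fin.all? λ u → Fin.all? λ v → (adj F u v Bool.≟ true) →-dec ¬? (ρ u Fin.≟ ρ v))

isCollapse-resp-≗ : ∀ F T → IsCollapse F T Respects _≗_
isCollapse-resp-≗ F T {ρ} {ρ′} ρ≗ρ′ c = record
  { below      = λ v → subst (_≼[ T ] v) (ρ≗ρ′ v) (below v)
  ; idempotent = λ v → trans (cong ρ′ (sym (ρ≗ρ′ v)))
                         (trans (sym (ρ≗ρ′ (ρ v))) (trans (idempotent v) (ρ≗ρ′ v)))
  ; colour     = λ v → trans (cong (col F) (sym (ρ≗ρ′ v))) (colour v)
  ; separates  = λ u v uv eq → separates u v uv (trans (ρ≗ρ′ u) (trans eq (sym (ρ≗ρ′ v))))
  }
  where open IsCollapse c

collapse-isCollapse : ∀ {F G T} (T-forest : IsForest T) {h : V F → V G} →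
  IsHom F G h → IsCollapse F T (Collapse.collapse T-forest h)
collapse-isCollapse {F} {G} T-forest {h} (edges , colours) = record
  { below      = collapse-≼
  ; idempotent = collapse-idempotent
  ; colour     = λ v → trans (sym (colours (collapse v))) (trans (cong (col G) (collapse-same v)) (colours v))
  ; separates  = λ u v uv eq → true≢false (trans (sym (edges u v uv))
      (trans (cong (λ w → adj G w (h v)) (trans (sym (collapse-same u)) (trans (cong h eq) (collapse-same v)))) (irr G (h v))))
  }
  where open Collapse T-forest h

module _ (F : Graph) {T : V F → V F → Bool} (T-forest : IsForest T) where

  fibre : Graph → (V F → V F) → ℕ
  fibre H ρ = count (isHom? F H ∩? λ h → Collapse.collapse T-forest h ≗? ρ) (allFuns (n F) (n H))

  private
    IsProper : Pred (V F → V F) 0ℓ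
    IsProper ρ = IsCollapse F T ρ × ¬ ρ ≗ (λ v → v)

    isProper? : Decidable IsProper
    isProper? ρ = isCollapse? F T ρ ×-dec ¬? (ρ ≗? λ v → v)

  properCollapses : List (V F → V F)
  properCollapses = filter isProper? (allFuns (n F) (n F))

  properCollapses-isCollapse : All (IsCollapse F T) properCollapses
  properCollapses-isCollapse = All.map proj₁ (AllP.all-filter isProper? (allFuns (n F) (n F)))

  properCollapses-proper : All (λ ρ → ¬ ρ ≗ (λ v → v)) properCollapses
  properCollapses-proper = All.map proj₂ (AllP.all-filter isProper? (allFuns (n F) (n F)))

  fibre-id≡pi-hom : ∀ H → fibre H (λ v → v) ≡ pi-hom F T H
  fibre-id≡pi-hom H = count-cong _ (isPI? F T H) (to , from) (allFuns (n F) (n H))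
    where
    to : ∀ {h} → IsHom F H h × Collapse.collapse T-forest h ≗ (λ v → v) → IsPastInjective F T H h
    to {h} (hom , ρ≗id) = hom , λ u v (u≼v , u≢v) hu≡hv →
      u≢v (≼-antisym T-forest u v u≼v (subst (_≼[ T ] u) (ρ≗id v) (collapse-least v u hu≡hv u≼v)))
      where open Collapse T-forest h
    from : ∀ {h} → IsPastInjective F T H h → IsHom F H h × Collapse.collapse T-forest h ≗ (λ v → v)
    from {h} (hom , past-inj) = hom , λ v → decidable-stable (collapse v Fin.≟ v)
      λ ρv≢v → past-inj (collapse v) v (collapse-≼ v , ρv≢v) (collapse-same v)
      where open Collapse T-forest h

  properFibres : Graph → ℕ
  properFibres H = sum (map (fibre H) properCollapses)

  -- Every homomorphism has exactly one collapse, and the identity is the only non-proper one.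
  hom≡pi-hom+properFibres : ∀ H → hom F H ≡ pi-hom F T H + properFibres H
  hom≡pi-hom+properFibres H = trans (count-partition (Funs (n F) (n F)) (isHom? F H) (Collapse.collapse T-forest) _≗?_
    (All.map (λ ρ≉id id≗ρ → ρ≉id (λ v → sym (id≗ρ v))) properCollapses-proper ∷ Enumerates.unique proper-enum)
    cover (allFuns (n F) (n H))) (cong (_+ properFibres H) (fibre-id≡pi-hom H))
    where
    proper-enum : Enumerates (Funs (n F) (n F)) IsProper properCollapses
    proper-enum = filter-enumerates (allFuns-enumerates (n F) (n F)) isProper?
      λ ρ≗ρ′ (c , ρ≉id) → isCollapse-resp-≗ F T ρ≗ρ′ c , λ ρ′≗id → ρ≉id (λ v → trans (ρ≗ρ′ v) (ρ′≗id v))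
    cover : ∀ {h} → IsHom F H h →
      SetoidMembership._∈_ (Funs (n F) (n F)) (Collapse.collapse T-forest h) ((λ v → v) ∷ properCollapses)
    cover {h} hom with Collapse.collapse T-forest h ≗? (λ v → v)
    ... | yes ρ≗id = here ρ≗id
    ... | no  ρ≉id = there (Enumerates.complete proper-enum (collapse-isCollapse {G = H} T-forest hom , ρ≉id))

-- The quotient of F by a collapse

module Quotient (F : Graph) {T : V F → V F → Bool} (T-forest : IsForest T)
                {ρ : V F → V F} (ρ-collapse : IsCollapse F T ρ) where

  open IsCollapse ρ-collapse

  QuotientEdge : V F → V F → Set
  QuotientEdge r s = Σ (V F) λ u → Σ (V F) λ v → ρ u ≡ r × ρ v ≡ s × Edge F u v

  quotientEdge? : ∀ r s → Dec (QuotientEdge r s)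
  quotientEdge? r s = Fin.any? λ u → Fin.any? λ v → ρ u Fin.≟ r ×-dec ρ v Fin.≟ s ×-dec adj F u v Bool.≟ true

  quotientEdges : EdgeSet (n F)
  quotientEdges = record
    { edge     = λ r s → does (quotientEdge? r s)
    ; edge-sym = λ r s → does-⇔ (mk⇔ swap swap) (quotientEdge? r s) (quotientEdge? s r)
    ; edge-irr = λ r → dec-false (quotientEdge? r r)
                   λ (u , v , ρu≡r , ρv≡r , uv) → separates u v uv (trans ρu≡r (sym ρv≡r))
    }
    where
    swap : ∀ {r s} → QuotientEdge r s → QuotientEdge s r
    swap (u , v , ρu≡r , ρv≡s , uv) = v , u , ρv≡s , ρu≡r , trans (Graph.sym F v u) uv

  module Fixed = Subset (λ v → ρ v Fin.≟ v)

  quotient : Graph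
  quotient = induced (withEdges F quotientEdges) Fixed.embed

  T/ρ : V quotient → V quotient → Bool
  T/ρ = restrict T Fixed.embed

  class : V F → V quotient
  class v = Fixed.index (ρ v) (idempotent v)

  embed-class : ∀ v → Fixed.embed (class v) ≡ ρ v
  embed-class v = Fixed.embed-index (ρ v) (idempotent v)

  class-embed : ∀ i → class (Fixed.embed i) ≡ i
  class-embed i = Fixed.embed-injective _ _ (trans (embed-class (Fixed.embed i)) (Fixed.P-embed i))

  quotient-smaller : ¬ ρ ≗ (λ v → v) → n quotient < n F
  quotient-smaller ρ≉id with Fin.¬∀⟶∃¬ (n F) (λ v → ρ v ≡ v) (λ v → ρ v Fin.≟ v) ρ≉id
  ... | v , ρv≢v = Fixed.size< v ρv≢v

  quotient-inDk : ∀ {k} → InDk k F T → InDk k quotient T/ρ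
  quotient-inDk ((T-tree , elim) , height) =
    (isTree-restrict Fixed.embed-injective T-forest (class r) class-r≼ , quotient-elim) ,
    heightAtMost-restrict Fixed.embed-injective height
    where
    r = root T-tree
    ρr≡r : ρ r ≡ r
    ρr≡r = proj₁ (proj₂ (proj₂ T-tree)) (ρ r) (below r)
    class-r≼ : ∀ j → Fixed.embed (class r) ≼[ T ] Fixed.embed j
    class-r≼ j = subst (_≼[ T ] Fixed.embed j) (sym (trans (embed-class r) ρr≡r)) (root-≼ T-tree (Fixed.embed j))
    quotient-elim : Eliminates quotient T/ρ
    quotient-elim i j ij with dec-true⁻ (quotientEdge? _ _) ij
    ... | u , v , ρu≡i , ρv≡j , uv = subst₂ (Comparable T) ρu≡i ρv≡j (ρ-comparable (elim u v uv))
      where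
      ρ-comparable : Comparable T u v → Comparable T (ρ u) (ρ v)
      ρ-comparable (inj₁ u≼v) = ≼-chain T-forest v (ρ u) (ρ v) (≼-trans T-forest _ _ _ (below u) u≼v) (below v)
      ρ-comparable (inj₂ v≼u) = ≼-chain T-forest u (ρ u) (ρ v) (below u) (≼-trans T-forest _ _ _ (below v) v≼u)

  fibre≡pi-hom : ∀ H → fibre F T-forest H ρ ≡ pi-hom quotient T/ρ H
  fibre≡pi-hom H = countFuns-≡ (isHom? F H ∩? λ h → Collapse.collapse T-forest h ≗? ρ) (isPI? quotient T/ρ H)
    (λ h≗h′ (hom , collapse≗ρ) →
       isHom-resp-≗ F H h≗h′ hom , λ v → trans (sym (collapse-resp-≗ T-forest h≗h′ v)) (collapse≗ρ v))
    (isPastInjective-resp-≗ quotient T/ρ H)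
    ((λ h → h ∘ Fixed.embed) , restrict-pi , restrict-injective)
    ((λ g → g ∘ class) , extend-fibre , extend-injective)
    where
    InFibre : (V F → V H) → Set
    InFibre h = IsHom F H h × Collapse.collapse T-forest h ≗ ρ

    constant-on-classes : ∀ {h} → InFibre h → ∀ v → h (ρ v) ≡ h v
    constant-on-classes {h} (_ , collapse≗ρ) v = trans (cong h (sym (collapse≗ρ v))) (Collapse.collapse-same T-forest h v)

    restrict-pi : ∀ {h} → InFibre h → IsPastInjective quotient T/ρ H (h ∘ Fixed.embed)
    restrict-pi {h} fib@((edges , colours) , collapse≗ρ) = (restrict-edges , colours ∘ Fixed.embed) , restrict-past-inj
      where
      restrict-edges : ∀ i j → Edge quotient i j → Edge H (h (Fixed.embed i)) (h (Fixed.embed j))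
      restrict-edges i j ij with dec-true⁻ (quotientEdge? _ _) ij
      ... | u , v , ρu≡i , ρv≡j , uv = subst₂ (Edge H)
        (trans (sym (constant-on-classes fib u)) (cong h ρu≡i))
        (trans (sym (constant-on-classes fib v)) (cong h ρv≡j))
        (edges u v uv)
      restrict-past-inj : ∀ i j → i ≺[ T/ρ ] j → h (Fixed.embed i) ≢ h (Fixed.embed j)
      restrict-past-inj i j (i≼j , i≢j) hi≡hj = i≢j (Fixed.embed-injective i j (≼-antisym T-forest _ _ i≼j
        (subst (_≼[ T ] Fixed.embed i) (trans (collapse≗ρ (Fixed.embed j)) (Fixed.P-embed j))
          (Collapse.collapse-least T-forest h (Fixed.embed j) (Fixed.embed i) hi≡hj i≼j))))

    restrict-injective : ∀ {h h′} → InFibre h → InFibre h′ → h ∘ Fixed.embed ≗ h′ ∘ Fixed.embed → h ≗ h′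
    restrict-injective {h} {h′} fib fib′ eq v = begin
      h v                      ≡⟨ constant-on-classes fib v ⟨
      h (ρ v)                  ≡⟨ cong h (embed-class v) ⟨
      h (Fixed.embed (class v))  ≡⟨ eq (class v) ⟩
      h′ (Fixed.embed (class v)) ≡⟨ cong h′ (embed-class v) ⟩
      h′ (ρ v)                 ≡⟨ constant-on-classes fib′ v ⟩
      h′ v                     ∎
      where open ≡-Reasoning

    extend-fibre : ∀ {g} → IsPastInjective quotient T/ρ H g → InFibre (g ∘ class)
    extend-fibre {g} ((edges , colours) , past-inj) = (extend-edges , extend-colours) , extend-collapse
      where
      extend-edges : ∀ u v → Edge F u v → Edge H (g (class u)) (g (class v))
      extend-edges u v uv = edges (class u) (class v)
        (dec-true (quotientEdge? _ _) (u , v , sym (embed-class u) , sym (embed-class v) , uv))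
      extend-colours : ∀ v → col H (g (class v)) ≡ col F v
      extend-colours v = trans (colours (class v)) (trans (cong (col F) (embed-class v)) (colour v))
      same-class : ∀ {w v} → ρ w ≡ ρ v → class w ≡ class v
      same-class ρw≡ρv = Fixed.embed-injective _ _ (trans (embed-class _) (trans ρw≡ρv (sym (embed-class _))))
      extend-collapse : ∀ v → Collapse.collapse T-forest (g ∘ class) v ≡ ρ v
      extend-collapse v = Collapse.collapse-unique T-forest (g ∘ class) v (ρ v) (below v)
        (cong g (same-class (idempotent v))) ρv-least
        where
        ρv-least : ∀ w → g (class w) ≡ g (class v) → w ≼[ T ] v → ρ v ≼[ T ] w
        ρv-least w gw≡gv w≼v with ≼-chain T-forest v (ρ w) (ρ v) (≼-trans T-forest _ _ _ (below w) w≼v) (below v)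
        ... | inj₂ ρv≼ρw = ≼-trans T-forest _ _ _ ρv≼ρw (below w)
        ... | inj₁ ρw≼ρv with ρ w Fin.≟ ρ v
        ...   | yes ρw≡ρv = subst (_≼[ T ] w) ρw≡ρv (below w)
        ...   | no  ρw≢ρv = ⊥-elim (past-inj (class w) (class v)
                  (subst₂ _≼[ T ]_ (sym (embed-class w)) (sym (embed-class v)) ρw≼ρv ,
                   λ cw≡cv → ρw≢ρv (trans (sym (embed-class w)) (trans (cong Fixed.embed cw≡cv) (embed-class v))))
                  gw≡gv)

    extend-injective : ∀ {g g′} → IsPastInjective quotient T/ρ H g → IsPastInjective quotient T/ρ H g′ →
      g ∘ class ≗ g′ ∘ class → g ≗ g′
    extend-injective {g} {g′} _ _ eq i = subst (λ j → g j ≡ g′ j) (class-embed i) (eq (Fixed.embed i))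

module Split (F : Graph) {P : Pred (V F) 0ℓ} (P? : Decidable P) (closed : ∀ u v → Edge F u v → P u → P v) where

  module In  = Subset P?
  module Out = Subset (∁? P?)

  inside : Graph
  inside = induced F In.embed

  outside : Graph
  outside = induced F Out.embed

  private
    closed⁻ : ∀ u v → Edge F u v → ¬ P u → ¬ P v
    closed⁻ u v uv ¬Pu Pv = ¬Pu (closed v u (trans (Graph.sym F v u) uv) Pv)

  module _ (H : Graph) where

    private
      glue-at : (V inside → V H) → (V outside → V H) → ∀ v → Dec (P v) → V H
      glue-at h₁ h₂ v (yes Pv) = h₁ (In.index v Pv)
      glue-at h₁ h₂ v (no ¬Pv) = h₂ (Out.index v ¬Pv)

      glue : (V inside → V H) × (V outside → V H) → V F → V H
      glue (h₁ , h₂) v = glue-at h₁ h₂ v (P? v)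

      glue-hom : ∀ {h₁ h₂} → IsHom inside H h₁ × IsHom outside H h₂ → IsHom F H (glue (h₁ , h₂))
      glue-hom {h₁} {h₂} ((edges₁ , colours₁) , (edges₂ , colours₂)) = glue-edges , glue-colours
        where
        glue-edges : ∀ u v → Edge F u v → Edge H (glue (h₁ , h₂) u) (glue (h₁ , h₂) v)
        glue-edges u v uv with P? u | P? v
        ... | yes Pu | yes Pv =
          edges₁ _ _ (subst₂ (Edge F) (sym (In.embed-index u Pu)) (sym (In.embed-index v Pv)) uv)
        ... | yes Pu | no ¬Pv = ⊥-elim (¬Pv (closed u v uv Pu))
        ... | no ¬Pu | yes Pv = ⊥-elim (closed⁻ u v uv ¬Pu Pv)
        ... | no ¬Pu | no ¬Pv =
          edges₂ _ _ (subst₂ (Edge F) (sym (Out.embed-index u ¬Pu)) (sym (Out.embed-index v ¬Pv)) uv)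
        glue-colours : ∀ v → col H (glue (h₁ , h₂) v) ≡ col F v
        glue-colours v with P? v
        ... | yes Pv = trans (colours₁ _) (cong (col F) (In.embed-index v Pv))
        ... | no ¬Pv = trans (colours₂ _) (cong (col F) (Out.embed-index v ¬Pv))

      glue-injective : ∀ {hs hs′ : (V inside → V H) × (V outside → V H)} →
        glue hs ≗ glue hs′ → (proj₁ hs ≗ proj₁ hs′) × (proj₂ hs ≗ proj₂ hs′)
      glue-injective {h₁ , h₂} {h₁′ , h₂′} eq = inside-eq , outside-eq
        where
        inside-eq : h₁ ≗ h₁′
        inside-eq i with P? (In.embed i) | eq (In.embed i)
        ... | yes Pv | e = subst (λ j → h₁ j ≡ h₁′ j) (In.index-embed i Pv) e
        ... | no ¬Pv | _ = ⊥-elim (¬Pv (In.P-embed i))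
        outside-eq : h₂ ≗ h₂′
        outside-eq i with P? (Out.embed i) | eq (Out.embed i)
        ... | yes Pv | _ = ⊥-elim (Out.P-embed i Pv)
        ... | no ¬Pv | e = subst (λ j → h₂ j ≡ h₂′ j) (Out.index-embed i ¬Pv) e

      restrict-injective : ∀ {h h′ : V F → V H} →
        h ∘ In.embed ≗ h′ ∘ In.embed → h ∘ Out.embed ≗ h′ ∘ Out.embed → h ≗ h′
      restrict-injective {h} {h′} in-eq out-eq v with P? v
      ... | yes Pv = subst (λ w → h w ≡ h′ w) (In.embed-index v Pv) (in-eq (In.index v Pv))
      ... | no ¬Pv = subst (λ w → h w ≡ h′ w) (Out.embed-index v ¬Pv) (out-eq (Out.index v ¬Pv))

    hom≡hom-inside*hom-outside : hom F H ≡ hom inside H * hom outside H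
    hom≡hom-inside*hom-outside = countFuns-* (isHom? F H) (isHom? inside H) (isHom? outside H)
      (isHom-resp-≗ F H) (isHom-resp-≗ inside H) (isHom-resp-≗ outside H)
      ( (λ (h : V F → V H) → h ∘ In.embed , h ∘ Out.embed)
      , (λ (edges , colours) → ((λ i j → edges (In.embed i) (In.embed j)) , λ i → colours (In.embed i)) ,
                               ((λ i j → edges (Out.embed i) (Out.embed j)) , λ i → colours (Out.embed i)))
      , (λ _ _ (in-eq , out-eq) → restrict-injective in-eq out-eq))
      (glue , glue-hom , λ _ _ → glue-injective)

module _ (F : Graph) {T : V F → V F → Bool} (T-forest : IsForest T) (H H′ : Graph) where

  properFibres-≡ : (∀ {ρ} (c : IsCollapse F T ρ) → ¬ ρ ≗ (λ v → v) →
                     pi-hom (Quotient.quotient F T-forest c) (Quotient.T/ρ F T-forest c) H ≡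
                     pi-hom (Quotient.quotient F T-forest c) (Quotient.T/ρ F T-forest c) H′) →
    properFibres F T-forest H ≡ properFibres F T-forest H′
  properFibres-≡ quotient-eq = sum-map-cong (All.zipWith (λ (c , ρ≉id) →
      trans (Quotient.fibre≡pi-hom F T-forest c H)
        (trans (quotient-eq c ρ≉id) (sym (Quotient.fibre≡pi-hom F T-forest c H′))))
    (properCollapses-isCollapse F T-forest , properCollapses-proper F T-forest))

-- Equivalence of (i) and (ii)

module _ {k : ℕ} {G G′ : Graph} where

  hom⇒pi-indistinguishable : HomIndistinguishable k G G′ → PiHomIndistinguishable k G G′
  hom⇒pi-indistinguishable hom-eq F T = go F T (<-wellFounded (n F))
    where
    go : ∀ F T → Acc _<_ (n F) → InDk k F T → pi-hom F T G ≡ pi-hom F T G′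
    go F T (acc smaller) d@((T-tree , elim) , height) = ℕ.+-cancelʳ-≡ (properFibres F T-forest G′) _ _ (begin
      pi-hom F T G + properFibres F T-forest G′  ≡⟨ cong (pi-hom F T G +_) quotients-eq ⟨
      pi-hom F T G + properFibres F T-forest G   ≡⟨ hom≡pi-hom+properFibres F T-forest G ⟨
      hom F G                                    ≡⟨ hom-eq F (T , (T-forest , elim) , height) ⟩
      hom F G′                                   ≡⟨ hom≡pi-hom+properFibres F T-forest G′ ⟩
      pi-hom F T G′ + properFibres F T-forest G′ ∎)
      where
      open ≡-Reasoning
      T-forest : IsForest T
      T-forest = proj₁ T-tree
      quotients-eq : properFibres F T-forest G ≡ properFibres F T-forest G′
      quotients-eq = properFibres-≡ F T-forest G G′ λ c ρ≉id → let open Quotient F T-forest c in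
        go quotient T/ρ (smaller (quotient-smaller ρ≉id)) (quotient-inDk d)

  pi⇒hom-indistinguishable : PiHomIndistinguishable k G G′ → HomIndistinguishable k G G′
  pi⇒hom-indistinguishable pi-eq F = go F (<-wellFounded (n F))
    where
    tree : ∀ F T → InDk k F T → hom F G ≡ hom F G′
    tree F T d@((T-tree , _) , _) = begin
      hom F G                                    ≡⟨ hom≡pi-hom+properFibres F T-forest G ⟩
      pi-hom F T G + properFibres F T-forest G   ≡⟨ cong₂ _+_ (pi-eq F T d) quotients-eq ⟩
      pi-hom F T G′ + properFibres F T-forest G′ ≡⟨ hom≡pi-hom+properFibres F T-forest G′ ⟨
      hom F G′                                   ∎
      where
      open ≡-Reasoning
      T-forest : IsForest T
      T-forest = proj₁ T-tree
      quotients-eq : properFibres F T-forest G ≡ properFibres F T-forest G′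
      quotients-eq = properFibres-≡ F T-forest G G′ λ c _ → let open Quotient F T-forest c in
        pi-eq quotient T/ρ (quotient-inDk d)

    go : ∀ F → Acc _<_ (n F) → TreeDepthAtMost k F → hom F G ≡ hom F G′
    go F (acc smaller) (T , (T-forest , elim) , height) with inhabited? (n F)
    ... | inj₁ empty = hom-≡-empty F {G} {G′} empty
    ... | inj₂ v₀ = trans (hom≡hom-inside*hom-outside G)
        (trans (cong₂ _*_ inside-eq outside-eq) (sym (hom≡hom-inside*hom-outside G′)))
      where
      r : V F
      r = proj₁ (minimal-below T-forest v₀)
      open Split F (λ v → T r v Bool.≟ true)
        (above-minimal-closed {F} T-forest elim (proj₁ (proj₂ (minimal-below T-forest v₀))))
      inside-eq : hom inside G ≡ hom inside G′
      inside-eq = tree inside (restrict T In.embed)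
        ((isTree-restrict In.embed-injective T-forest (In.index r (≼-refl T-forest r))
           (λ j → subst (_≼[ T ] In.embed j) (sym (In.embed-index r (≼-refl T-forest r))) (In.P-embed j)) ,
          λ i j → elim (In.embed i) (In.embed j)) ,
         heightAtMost-restrict In.embed-injective height)
      outside-eq : hom outside G ≡ hom outside G′
      outside-eq = go outside (smaller (Out.size< r λ r⋠r → r⋠r (≼-refl T-forest r)))
        (restrict T Out.embed , (isForest-restrict Out.embed-injective T-forest , λ i j → elim (Out.embed i) (Out.embed j)) ,
         heightAtMost-restrict Out.embed-injective height)

theorem15 : (k : ℕ) (G G′ : Graph) →
    ((∀ (F : Graph) → TreeDepthAtMost k F → hom F G ≡ hom F G′)
      ⇔ (∀ (F : Graph) (T : V F → V F → Bool) → InDk k F T → pi-hom F T G ≡ pi-hom F T G′))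
    × ((∀ (F : Graph) → TreeDepthAtMost k F → hom F G ≡ hom F G′)
      ⇔ (∀ (F : Graph) (T : V F → V F → Bool) → InDk k F T → pp-hom F T G ≡ pp-hom F T G′))
theorem15 k G G′ = hom⇔pi , pi⇔pp-indistinguishable k G G′ ⇔-∘ hom⇔pi
  where
  hom⇔pi : HomIndistinguishable k G G′ ⇔ PiHomIndistinguishable k G G′
  hom⇔pi = mk⇔ (hom⇒pi-indistinguishable {k} {G} {G′}) (pi⇒hom-indistinguishable {k} {G} {G′})
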